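{- Let $d \geq 2$ and $n_1,\dots,n_d \geq 1$ be integers, and let $G_1$ and $G_2$ be graphs with non-empty edge sets. Then $K_{n_1,\dots,n_d}$ is a subgraph of $G_1\times G_2$ if and only if there exist positive integers $a_1,\dots,a_d,b_1,\dots,b_d$ such that $K_{a_1,\dots,a_d}$ is a subgraph of $G_1$, $K_{b_1,\dots,b_d}$ is a subgraph of $G_2$, and $n_i\leq a_ib_i$ for all $i\in\{1,\dots,d\}$.
   Context: All graphs are finite and simple; "subgraph" means a subgraph isomorphic to the given graph. The direct product $G_1\times G_2$ has vertex set $V(G_1)\times V(G_2)$, with $(a,v)(b,u)$ an edge iff $ab\in E(G_1)$ and $uv\in E(G_2)$. $K_{n_1,\dots,n_d}$ denotes the complete $d$-partite graph with parts of sizes $n_1,\dots,n_d$. -}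

module Defs where

open import Data.Nat using (ℕ)
open import Data.Fin using (Fin)
open import Data.List using (List; cartesianProduct; concatMap; map; allFin)
open import Data.List.Membership.Propositional using (_∈_)
open import Data.Product using (Σ; _×_; _,_; proj₁)
open import Relation.Nullary using (¬_)
open import Relation.Binary.PropositionalEquality as Eq using (_≡_)
open import Function.Definitions using (Injective)

Finite : Set → Set
Finite A = Σ (List A) λ xs → ∀ x → x ∈ xs

record Graph : Set₁ where
  field
    V      : Set
    E      : V → V → Set
    sym    : ∀ {u v} → E u v → E v u
    irrefl : ∀ {v} → ¬ E v v
    finite : Finite V
open Graph public

_⊑_ : Graph → Graph → Set
H ⊑ G = Σ (V H → V G) λ f → Injective _≡_ _≡_ f × (∀ {u v} → E H u v → E G (f u) (f v))

HasEdge : Graph → Set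
HasEdge G = Σ (V G) λ u → Σ (V G) λ v → E G u v

_×ᴳ_ : Graph → Graph → Graph
G₁ ×ᴳ G₂ = record
  { V = V G₁ × V G₂
  ; E = λ { (a , v) (b , u) → E G₁ a b × E G₂ v u }
  ; sym = λ { (e₁ , e₂) → sym G₁ e₁ , sym G₂ e₂ }
  ; irrefl = λ { (e₁ , _) → irrefl G₁ e₁ }
  ; finite = finProd
  }
  where
  open import Data.List.Membership.Propositional.Properties using (∈-cartesianProduct⁺)
  finProd : Finite (V G₁ × V G₂)
  finProd with finite G₁ | finite G₂
  ... | (xs , p) | (ys , q) = cartesianProduct xs ys , λ { (x , y) → ∈-cartesianProduct⁺ (p x) (q y) }

-- Complete d-partite graph K_{n_0,…,n_{d-1}} (parts indexed by Fin d, part i of size n i):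
-- vertices are pairs (i , j) with j : Fin (n i); two vertices are adjacent iff
-- they lie in different parts.
K : (d : ℕ) → (Fin d → ℕ) → Graph
K d n = record
  { V = Σ (Fin d) (λ i → Fin (n i))
  ; E = λ x y → ¬ (proj₁ x ≡ proj₁ y)
  ; sym = λ ne eq → ne (Eq.sym eq)
  ; irrefl = λ ne → ne Eq.refl
  ; finite = finΣ
  }
  where
  open import Data.List.Membership.Propositional.Properties using (∈-concatMap⁺; ∈-allFin)
  open import Data.List.Membership.Propositional using (lose)
  open import Data.List.Relation.Unary.Any.Properties using (map⁺)
  open import Data.List.Relation.Unary.Any using (here)
  finΣ : Finite (Σ (Fin d) (λ i → Fin (n i)))
  finΣ = concatMap (λ i → map (i ,_) (allFin (n i))) (allFin d)
       , λ { (i , j) → ∈-concatMap⁺ (λ i → map (i ,_) (allFin (n i))) (lose (∈-allFin i) (map⁺ (Data.List.Relation.Unary.Any.map (Eq.cong (i ,_)) (∈-allFin j)))) }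

-- An embedding of K_{n_1,…,n_d} into G₁ × G₂ projects part i onto sets
-- A_i ⊆ V(G₁) and B_i ⊆ V(G₂). Distinct parts are completely joined and
-- graphs have no loops, so the A_i are pairwise disjoint and span a copy of
-- K_{|A_1|,…,|A_d|} in G₁ (likewise the B_i in G₂), while part i embeds
-- into A_i × B_i, giving n_i ≤ |A_i| |B_i|. Conversely, given copies of
-- K_{a_1,…,a_d} and K_{b_1,…,b_d}, send part i injectively into the grid of
-- pairs formed by the i-th parts.
module Submission where

open import Defs
open import Data.Nat using (ℕ; suc; _≤_; _*_; _≥_; >-nonZero⁻¹)
open import Data.Fin using (Fin; zero; suc; fromℕ<; _≟_)
open import Data.Fin.Properties
  using (any?; injective⇒≤; inject≤-injective; *↔×; inj⇒≟; nonZeroIndex)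
open import Data.List.Relation.Unary.Any as Any using ()
open import Data.List.Membership.Setoid.Properties using (index-injective)
open import Data.Product using (Σ; _×_; _,_; proj₁; proj₂; ∃)
open import Data.Product.Properties using (×-≡,≡→≡)
open import Function using (_∘_)
open import Function.Bundles using (_⇔_; mk⇔; _↣_; mk↣; Injection)
open import Function.Definitions using (Injective)
open import Function.Construct.Composition using (_↣-∘_)
open import Function.Properties.Inverse using (↔⇒↣; ↔-sym)
open import Relation.Nullary using (¬_; yes; no; contradiction)
open import Relation.Binary.Definitions using (DecidableEquality)
open import Relation.Binary.PropositionalEquality as ≡
  using (_≡_; refl; cong; subst; setoid; module ≡-Reasoning)

Finite⇒DecidableEquality : ∀ {A : Set} → Finite A → DecidableEquality A
Finite⇒DecidableEquality {A} (_ , xs-complete) =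
  inj⇒≟ (mk↣ {to = Any.index ∘ xs-complete}
               (λ {x} {y} → index-injective (setoid A) (xs-complete x) (xs-complete y)))

Σ-fibre-injective : ∀ {A : Set} {B : A → Set} {a : A} {x y : B a} →
                    _≡_ {A = Σ A B} (a , x) (a , y) → x ≡ y
Σ-fibre-injective refl = refl

↣×⇒≤* : ∀ {m a b} → Fin m ↣ (Fin a × Fin b) → m ≤ a * b
↣×⇒≤* {a = a} {b} f = injective⇒≤ (Injection.injective (↔⇒↣ (↔-sym (*↔× {a} {b})) ↣-∘ f))

≤*⇒↣× : ∀ {m a b} → m ≤ a * b → Fin m ↣ (Fin a × Fin b)
≤*⇒↣× {a = a} {b} m≤ab = ↔⇒↣ (*↔× {a} {b}) ↣-∘ mk↣ (inject≤-injective m≤ab m≤ab _ _)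

-- The image of g, listed without repetition as g ∘ point; g j is its
-- entry number index j.
record Image {m : ℕ} {B : Set} (g : Fin m → B) : Set where
  field
    size            : ℕ
    point           : Fin size → Fin m
    index           : Fin m → Fin size
    point-injective : Injective _≡_ _≡_ (g ∘ point)
    point-index     : ∀ j → g (point (index j)) ≡ g j

image-suc-seen : ∀ {m B} {g : Fin (suc m) → B} (im : Image (g ∘ suc)) →
                 ∃ (λ x → g (suc (Image.point im x)) ≡ g zero) → Image g
image-suc-seen im (x , gx≡g0) = record
  { size            = size
  ; point           = suc ∘ point
  ; index           = λ { zero → x ; (suc j) → index j }
  ; point-injective = point-injective
  ; point-index     = λ { zero → gx≡g0 ; (suc j) → point-index j }
  }
  where open Image im

image-suc-new : ∀ {m B} {g : Fin (suc m) → B} (im : Image (g ∘ suc)) →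
                ¬ ∃ (λ x → g (suc (Image.point im x)) ≡ g zero) → Image g
image-suc-new {g = g} im unseen = record
  { size            = suc size
  ; point           = point′
  ; index           = λ { zero → zero ; (suc j) → suc (index j) }
  ; point-injective = injective
  ; point-index     = λ { zero → refl ; (suc j) → point-index j }
  }
  where
  open Image im
  point′ : Fin (suc size) → Fin (suc _)
  point′ zero    = zero
  point′ (suc x) = suc (point x)
  injective : Injective _≡_ _≡_ (g ∘ point′)
  injective {zero}  {zero}  _  = refl
  injective {zero}  {suc y} eq = contradiction (y , ≡.sym eq) unseen
  injective {suc x} {zero}  eq = contradiction (x , eq) unseen
  injective {suc x} {suc y} eq = cong suc (point-injective eq)

image : ∀ {m B} → DecidableEquality B → (g : Fin m → B) → Image g
image {0} _ g = record
  { size = 0 ; point = λ () ; index = λ () ; point-injective = λ {} ; point-index = λ () }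
image {suc m} _≟ᴮ_ g with image _≟ᴮ_ (g ∘ suc)
... | im with any? (λ x → g (suc (Image.point im x)) ≟ᴮ g zero)
...   | yes seen   = image-suc-seen im seen
...   | no  unseen = image-suc-new im unseen

module PartImages {d : ℕ} {n : Fin d → ℕ} {G : Graph} (f : V (K d n) → V G)
                  (f-hom : ∀ {u v} → E (K d n) u v → E G (f u) (f v)) where

  partImage : ∀ i → Image (λ j → f (i , j))
  partImage i = image (Finite⇒DecidableEquality (finite G)) (λ j → f (i , j))

  open module PartImage i = Image (partImage i) public
    using (point; index; point-injective; point-index)

  partSize : Fin d → ℕ
  partSize i = Image.size (partImage i)

  partSize-positive : (∀ i → 1 ≤ n i) → ∀ i → 1 ≤ partSize i
  partSize-positive n-pos i = >-nonZero⁻¹ _ {{nonZeroIndex (index i (fromℕ< (n-pos i)))}}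

  partImages-⊑ : K d partSize ⊑ G
  partImages-⊑ = vertex , injective , f-hom
    where
    vertex : V (K d partSize) → V G
    vertex (i , x) = f (i , point i x)
    injective : Injective _≡_ _≡_ vertex
    injective {i , x} {k , y} eq with i ≟ k
    ... | yes refl = cong (i ,_) (point-injective i eq)
    ... | no  i≢k  = contradiction (subst (E G (vertex (i , x))) (≡.sym eq) (f-hom i≢k)) (irrefl G)

  index-≡⇒≡ : ∀ {i j j′} → index i j ≡ index i j′ → f (i , j) ≡ f (i , j′)
  index-≡⇒≡ {i} {j} {j′} eq = begin
    f (i , j)                     ≡⟨ ≡.sym (point-index i j) ⟩
    f (i , point i (index i j))   ≡⟨ cong (λ x → f (i , point i x)) eq ⟩
    f (i , point i (index i j′))  ≡⟨ point-index i j′ ⟩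
    f (i , j′)                    ∎
    where open ≡-Reasoning

SplitsAcross : (d : ℕ) → (Fin d → ℕ) → Graph → Graph → Set
SplitsAcross d n G₁ G₂ =
  Σ (Fin d → ℕ) λ a → Σ (Fin d → ℕ) λ b →
    (∀ i → 1 ≤ a i) × (∀ i → 1 ≤ b i) × K d a ⊑ G₁ × K d b ⊑ G₂ × (∀ i → n i ≤ a i * b i)

⊑×ᴳ⇒splitsAcross : ∀ {d n G₁ G₂} → (∀ i → 1 ≤ n i) →
                   K d n ⊑ (G₁ ×ᴳ G₂) → SplitsAcross d n G₁ G₂
⊑×ᴳ⇒splitsAcross {G₁ = G₁} {G₂} n-pos (f , f-injective , f-hom) =
  P₁.partSize , P₂.partSize ,
  P₁.partSize-positive n-pos , P₂.partSize-positive n-pos ,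
  P₁.partImages-⊑ , P₂.partImages-⊑ ,
  λ i → ↣×⇒≤* (mk↣ (indices-injective i))
  where
  module P₁ = PartImages {G = G₁} (proj₁ ∘ f) (λ e → proj₁ (f-hom e))
  module P₂ = PartImages {G = G₂} (proj₂ ∘ f) (λ e → proj₂ (f-hom e))
  indices-injective : ∀ i → Injective _≡_ _≡_ (λ j → P₁.index i j , P₂.index i j)
  indices-injective i eq = Σ-fibre-injective (f-injective (×-≡,≡→≡
    (P₁.index-≡⇒≡ (cong proj₁ eq) , P₂.index-≡⇒≡ (cong proj₂ eq))))

splitsAcross⇒⊑×ᴳ : ∀ {d n G₁ G₂} → SplitsAcross d n G₁ G₂ → K d n ⊑ (G₁ ×ᴳ G₂)
splitsAcross⇒⊑×ᴳ {d} {n} {G₁} {G₂}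
  (a , b , _ , _ , (g , g-injective , g-hom) , (h , h-injective , h-hom) , n≤ab) =
  vertex , injective , λ i≢k → g-hom i≢k , h-hom i≢k
  where
  split : ∀ i → Fin (n i) ↣ (Fin (a i) × Fin (b i))
  split i = ≤*⇒↣× (n≤ab i)
  vertex : V (K d n) → V (G₁ ×ᴳ G₂)
  vertex (i , j) = let x , y = Injection.to (split i) j in g (i , x) , h (i , y)
  injective : Injective _≡_ _≡_ vertex
  injective {i , j} {k , j′} eq with cong proj₁ (g-injective (cong proj₁ eq))
  ... | refl = cong (i ,_) (Injection.injective (split i) (×-≡,≡→≡
    (Σ-fibre-injective (g-injective (cong proj₁ eq)) , Σ-fibre-injective (h-injective (cong proj₂ eq)))))

theorem6 : (d : ℕ) → d ≥ 2 → (n : Fin d → ℕ) → (∀ i → 1 ≤ n i)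
    → (G₁ G₂ : Graph) → HasEdge G₁ → HasEdge G₂
    → (K d n ⊑ (G₁ ×ᴳ G₂))
      ⇔ Σ (Fin d → ℕ) (λ a → Σ (Fin d → ℕ) (λ b →
          (∀ i → 1 ≤ a i) × (∀ i → 1 ≤ b i)
          × K d a ⊑ G₁ × K d b ⊑ G₂
          × (∀ i → n i ≤ a i * b i)))
theorem6 _ _ _ n-pos G₁ G₂ _ _ = mk⇔ (⊑×ᴳ⇒splitsAcross {G₁ = G₁} {G₂} n-pos) (splitsAcross⇒⊑×ᴳ {G₁ = G₁} {G₂})
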